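{- $\mathcal Q_p[\mathcal U]$ has the polynomial separation property under the empty ontology: there is a polynomial $p$ such that every $\mathcal Q_p[\mathcal U]$-separable example set $E$ is separated by some $\varkappa\in\mathcal Q_p[\mathcal U]$ with $|\varkappa|\le p(|E|)$.
   Context: Strict semantics over $\mathbb N$: $\mathcal I,n\models\varphi\,\mathcal U\,\psi$ iff there is $m>n$ with $\mathcal I,m\models\psi$ and $\mathcal I,k\models\varphi$ for all $n<k<m$. A data instance $\mathcal D$ is a finite set of facts $A(\ell)$, $\ell\in\mathbb N$; $\mathcal D\models\varkappa(0)$ means $\mathcal I,0\models\varkappa$ in every interpretation $\mathcal I$ in which all facts of $\mathcal D$ hold. $\mathcal Q_p[\mathcal U]$ consists of queries $\rho_0\wedge(\lambda_1\,\mathcal U\,(\rho_1\wedge(\lambda_2\,\mathcal U\,(\dots(\lambda_n\,\mathcal U\,\rho_n)\dots))))$ with each $\rho_i$ a (possibly empty) conjunction of atoms and each $\lambda_i$ a conjunction of atoms or $\bot$. An example set $E=(E^+,E^-)$ of finite sets of data instances is separated by $\varkappa$ if $\mathcal D\models\varkappa(0)$ for all $\mathcal D\in E^+$ and $\mathcal D\not\models\varkappa(0)$ for all $\mathcal D\in E^-$; it is $\mathcal Q_p[\mathcal U]$-separable if some such query separates it. Sizes are numbers of symbols, timestamps in unary. -}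

module Defs where

open import Data.Nat using (ℕ; suc; _+_; _*_; _^_; _<_; _≤_)
open import Data.Bool using (Bool; true)
open import Data.List using (List; length; map)
open import Data.Nat.ListAction using (sum)
open import Data.List.Relation.Unary.All using (All)
open import Data.List.Membership.Propositional using (_∈_)
open import Data.Maybe using (Maybe; just; nothing)
open import Data.Product using (_×_; _,_; ∃; Σ)
open import Data.Empty using (⊥)
open import Relation.Nullary using (¬_)
open import Relation.Binary.PropositionalEquality using (_≡_)

Atom : Set
Atom = ℕ

-- A fact A(ℓ) is a pair (A , ℓ); a data instance is a finite set of facts,
-- represented as a list (duplicates are harmless).
Fact : Set
Fact = Atom × ℕ

DataInstance : Set
DataInstance = List Fact

Interp : Set
Interp = Atom → ℕ → Bool

-- A conjunction of atoms (empty list = ⊤).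
Conj : Set
Conj = List Atom

-- λ_i : a conjunction of atoms (just xs) or ⊥ (nothing).
Lam : Set
Lam = Maybe Conj

-- Queries of Q_p[U]:
--   rho ρ                    stands for  ρ
--   until ρ λ q              stands for  ρ ∧ (λ U q)
data Query : Set where
  rho   : Conj → Query
  until : Conj → Lam → Query → Query

HoldsConj : Interp → ℕ → Conj → Set
HoldsConj I n xs = All (λ a → I a n ≡ true) xs

HoldsLam : Interp → ℕ → Lam → Set
HoldsLam I n nothing   = ⊥
HoldsLam I n (just xs) = HoldsConj I n xs

_,_⊨_ : Interp → ℕ → Query → Set
I , n ⊨ rho ρ       = HoldsConj I n ρ
I , n ⊨ until ρ l q =
  HoldsConj I n ρ ×
  ∃ λ m → n < m × (I , m ⊨ q) × (∀ k → n < k → k < m → HoldsLam I k l)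

ModelOf : Interp → DataInstance → Set
ModelOf I D = ∀ a ℓ → (a , ℓ) ∈ D → I a ℓ ≡ true

Entails : DataInstance → Query → Set
Entails D κ = ∀ (I : Interp) → ModelOf I D → I , 0 ⊨ κ

record ExampleSet : Set where
  constructor mkE
  field
    pos : List DataInstance
    neg : List DataInstance
open ExampleSet public

Separates : Query → ExampleSet → Set
Separates κ E = All (λ D → Entails D κ) (pos E) × All (λ D → ¬ Entails D κ) (neg E)

Separable : ExampleSet → Set
Separable E = ∃ λ κ → Separates κ E

conjSize : Conj → ℕ
conjSize xs = suc (length xs)

lamSize : Lam → ℕ
lamSize nothing   = 1
lamSize (just xs) = conjSize xs

querySize : Query → ℕ
querySize (rho ρ)       = conjSize ρ
querySize (until ρ l q) = conjSize ρ + lamSize l + querySize q + 2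

-- A fact A(ℓ) with ℓ written in unary.
factSize : Fact → ℕ
factSize (a , ℓ) = suc (suc ℓ)

instanceSize : DataInstance → ℕ
instanceSize D = suc (sum (map factSize D))

exampleSize : ExampleSet → ℕ
exampleSize E = suc (sum (map instanceSize (pos E)) + sum (map instanceSize (neg E)))

{-# OPTIONS --safe #-}
module Submission where

open import Defs
open import Data.Nat using (ℕ; zero; suc; _+_; _*_; _^_; _≤_; _<_; z≤n; s≤s)
open import Data.Nat.Properties
open import Data.Nat.ListAction using (sum)
open import Data.Nat.ListAction.Properties using (sum-++)
open import Data.Nat.Tactic.RingSolver using (solve-∀)
open import Data.Bool using (true)
open import Data.Maybe using (just; nothing)
open import Data.Product using (_×_; ∃-syntax; _,_; proj₁; proj₂)
open import Data.Product.Properties using (≡-dec)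
open import Data.List using (List; []; _∷_; _++_; map; length; filter)
open import Data.List.Properties using (length-++; length-map; length-filter; map-++)
open import Data.List.Relation.Unary.All as All using ([]; _∷_; all?)
open import Data.List.Relation.Unary.Any using (here; there)
open import Data.List.Membership.Propositional using (_∈_; _∉_)
open import Data.List.Membership.Propositional.Properties
  using (∈-filter⁺; ∈-filter⁻; ∈-++⁺ˡ; ∈-++⁺ʳ; ∈-map⁺)
import Data.List.Membership.DecPropositional as DecMembership
open import Data.Empty using (⊥-elim)
open import Function using (_∘_)
open import Function.Bundles using (_⇔_; mk⇔; Equivalence)
open import Function.Construct.Identity using (⇔-id)
open import Function.Construct.Symmetry using (⇔-sym)
open import Function.Construct.Composition using (_⇔-∘_)
open import Relation.Nullary using (¬_; yes; no; does)
open import Relation.Nullary.Decidable using (dec-true)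
open import Relation.Binary.PropositionalEquality using (_≡_; refl; sym; cong; subst; module ≡-Reasoning)

-- Entailment from D is truth in the least model of D, in which nothing holds
-- after the last timestamp. So every positive example makes the part of a
-- separating query below its first |E| untils trivially true, and that part can
-- be cut off. Moreover, only atoms occurring in E are ever true in the least
-- models of examples: a conjunction mentioning another atom is equivalent to a
-- single fresh atom, and any other conjunction to a duplicate-free list of
-- atoms of E. The resulting query has at most |E| + 1 layers, each of size O(|E|).

open DecMembership (≡-dec _≟_ _≟_) using () renaming (_∈?_ to _∈ᶠ?_)
open DecMembership _≟_ using () renaming (_∈?_ to _∈ᵃ?_)

until-map : ∀ {I J ρ ρ′ l l′ q q′} →
  (∀ n → HoldsConj I n ρ → HoldsConj J n ρ′) →
  (∀ n → HoldsLam I n l → HoldsLam J n l′) →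
  (∀ n → I , n ⊨ q → J , n ⊨ q′) →
  ∀ n → I , n ⊨ until ρ l q → J , n ⊨ until ρ′ l′ q′
until-map f g h n (hρ , m , n<m , hq , hλ) = f n hρ , m , n<m , h m hq , λ k n<k k<m → g k (hλ k n<k k<m)

until-cong : ∀ {I ρ ρ′ l l′ q q′} →
  (∀ n → HoldsConj I n ρ ⇔ HoldsConj I n ρ′) →
  (∀ n → HoldsLam I n l ⇔ HoldsLam I n l′) →
  (∀ n → I , n ⊨ q ⇔ I , n ⊨ q′) →
  ∀ n → I , n ⊨ until ρ l q ⇔ I , n ⊨ until ρ′ l′ q′
until-cong ρ⇔ l⇔ q⇔ n = mk⇔
  (until-map (Equivalence.to ∘ ρ⇔) (Equivalence.to ∘ l⇔) (Equivalence.to ∘ q⇔) n)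
  (until-map (Equivalence.from ∘ ρ⇔) (Equivalence.from ∘ l⇔) (Equivalence.from ∘ q⇔) n)

_⊑_ : Interp → Interp → Set
I ⊑ J = ∀ a n → I a n ≡ true → J a n ≡ true

HoldsConj-mono : ∀ {I J} → I ⊑ J → ∀ n xs → HoldsConj I n xs → HoldsConj J n xs
HoldsConj-mono I⊑J n xs = All.map (I⊑J _ n)

HoldsLam-mono : ∀ {I J} → I ⊑ J → ∀ n l → HoldsLam I n l → HoldsLam J n l
HoldsLam-mono I⊑J n (just xs) = HoldsConj-mono I⊑J n xs

⊨-mono : ∀ {I J} → I ⊑ J → ∀ q n → I , n ⊨ q → J , n ⊨ q
⊨-mono I⊑J (rho ρ)       n = HoldsConj-mono I⊑J n ρ
⊨-mono I⊑J (until ρ l q) n =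
  until-map (λ k → HoldsConj-mono I⊑J k ρ) (λ k → HoldsLam-mono I⊑J k l) (⊨-mono I⊑J q) n

canonical : DataInstance → Interp
canonical D a n = does ((a , n) ∈ᶠ? D)

canonical⇒∈ : ∀ D {a n} → canonical D a n ≡ true → (a , n) ∈ D
canonical⇒∈ D {a} {n} e with (a , n) ∈ᶠ? D
canonical⇒∈ D e  | yes a∈D = a∈D
canonical⇒∈ D () | no _

canonical-least : ∀ {I} D → ModelOf I D → canonical D ⊑ I
canonical-least D I⊨D a n = I⊨D a n ∘ canonical⇒∈ D

entails⇔canonical : ∀ D q → Entails D q ⇔ canonical D , 0 ⊨ q
entails⇔canonical D q = mk⇔
  (λ ent → ent (canonical D) (λ a ℓ → dec-true ((a , ℓ) ∈ᶠ? D)))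
  (λ holds I I⊨D → ⊨-mono (canonical-least D I⊨D) q 0 holds)

entails-cong : ∀ D {q q′} → canonical D , 0 ⊨ q ⇔ canonical D , 0 ⊨ q′ → Entails D q ⇔ Entails D q′
entails-cong D {q} {q′} q⇔q′ = ⇔-sym (entails⇔canonical D q′) ⇔-∘ (q⇔q′ ⇔-∘ entails⇔canonical D q)

Trivial : Query → Set
Trivial (rho ρ)       = ρ ≡ []
Trivial (until ρ l q) = ρ ≡ [] × Trivial q

trivial-holds : ∀ {I} q n → Trivial q → I , n ⊨ q
trivial-holds (rho .[])       n refl       = []
trivial-holds (until .[] l q) n (refl , t) =
  [] , suc n , ≤-refl , trivial-holds q (suc n) t , λ k n<k k<1+n → ⊥-elim (<⇒≱ n<k (≤-pred k<1+n))

-- Past the last until, the query that remains is taken to be the trivial one.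
suffix : ℕ → Query → Query
suffix zero    q             = q
suffix (suc j) (rho ρ)       = rho []
suffix (suc j) (until ρ l q) = suffix j q

truncate : ℕ → Query → Query
truncate zero    q             = rho []
truncate (suc b) (rho ρ)       = rho ρ
truncate (suc b) (until ρ l q) = until ρ l (truncate b q)

suffix-holds-later : ∀ {I} j q n → I , n ⊨ q → ∃[ m ] (j + n ≤ m × I , m ⊨ suffix j q)
suffix-holds-later zero    q             n holds = n , ≤-refl , holds
suffix-holds-later (suc j) (rho ρ)       n holds = suc j + n , ≤-refl , []
suffix-holds-later (suc j) (until ρ l q) n (_ , m , n<m , hq , _)
  with m′ , j+m≤m′ , hsuffix ← suffix-holds-later j q m hq =
  m′ , ≤-trans (≤-reflexive (sym (+-suc j n))) (≤-trans (+-monoʳ-≤ j n<m) j+m≤m′) , hsuffix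

trivial-if-nothing-holds-beyond : ∀ {I} q m → (∀ a k → m ≤ k → ¬ I a k ≡ true) → I , m ⊨ q → Trivial q
trivial-if-nothing-holds-beyond (rho [])            m none _              = refl
trivial-if-nothing-holds-beyond (rho (a ∷ _))       m none (p ∷ _)        = ⊥-elim (none a m ≤-refl p)
trivial-if-nothing-holds-beyond (until [] l q)      m none (_ , m′ , m<m′ , hq , _) =
  refl , trivial-if-nothing-holds-beyond q m′ (λ a k m′≤k → none a k (≤-trans (<⇒≤ m<m′) m′≤k)) hq
trivial-if-nothing-holds-beyond (until (a ∷ _) l q) m none ((p ∷ _) , _) = ⊥-elim (none a m ≤-refl p)

truncate-equiv : ∀ b q → Trivial (suffix b q) → ∀ {I} n → I , n ⊨ q ⇔ I , n ⊨ truncate b q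
truncate-equiv zero    q             t n = mk⇔ (λ _ → []) (λ _ → trivial-holds q n t)
truncate-equiv (suc b) (rho ρ)       t n = ⇔-id _
truncate-equiv (suc b) (until ρ l q) t n = until-cong (λ _ → ⇔-id _) (λ _ → ⇔-id _) (truncate-equiv b q t) n

∈⇒≤sum : ∀ {x xs} → x ∈ xs → x ≤ sum xs
∈⇒≤sum {xs = x ∷ xs} (here refl) = m≤m+n x (sum xs)
∈⇒≤sum {xs = y ∷ xs} (there x∈xs) = ≤-trans (∈⇒≤sum x∈xs) (m≤n+m (sum xs) y)

fresh : List Atom → Atom
fresh L = suc (sum L)

fresh∉ : ∀ L → fresh L ∉ L
fresh∉ L fresh∈L = <-irrefl refl (∈⇒≤sum fresh∈L)

AtomsIn : List Atom → Interp → Set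
AtomsIn L I = ∀ a n → I a n ≡ true → a ∈ L

module Normalise (L : List Atom) where

  -- An atom outside L never holds, and fresh L is a canonical such atom. Listing
  -- the atoms of a conjunction in the order of L removes duplicates, so its length
  -- is at most |L|.
  normConj : Conj → Conj
  normConj xs with all? (_∈ᵃ? L) xs
  ... | yes _ = filter (_∈ᵃ? xs) L
  ... | no  _ = fresh L ∷ []

  normLam : Lam → Lam
  normLam nothing   = nothing
  normLam (just xs) = just (normConj xs)

  normalise : Query → Query
  normalise (rho ρ)       = rho (normConj ρ)
  normalise (until ρ l q) = until (normConj ρ) (normLam l) (normalise q)

  module _ {I : Interp} (I⊆L : AtomsIn L I) where

    normConj-equiv : ∀ n xs → HoldsConj I n xs ⇔ HoldsConj I n (normConj xs)
    normConj-equiv n xs with all? (_∈ᵃ? L) xs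
    ... | yes xs⊆L = mk⇔
      (λ h → All.tabulate (λ a∈ → All.lookup h (proj₂ (∈-filter⁻ (_∈ᵃ? xs) {xs = L} a∈))))
      (λ h → All.tabulate (λ a∈ → All.lookup h (∈-filter⁺ (_∈ᵃ? xs) (All.lookup xs⊆L a∈) a∈)))
    ... | no xs⊈L = mk⇔
      (λ h → ⊥-elim (xs⊈L (All.map (I⊆L _ n) h)))
      (λ { (p ∷ []) → ⊥-elim (fresh∉ L (I⊆L (fresh L) n p)) })

    normLam-equiv : ∀ n l → HoldsLam I n l ⇔ HoldsLam I n (normLam l)
    normLam-equiv n nothing   = ⇔-id _
    normLam-equiv n (just xs) = normConj-equiv n xs

    normalise-equiv : ∀ q n → I , n ⊨ q ⇔ I , n ⊨ normalise q
    normalise-equiv (rho ρ)       n = normConj-equiv n ρ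
    normalise-equiv (until ρ l q) n =
      until-cong (λ k → normConj-equiv k ρ) (λ k → normLam-equiv k l) (normalise-equiv q) n

  conjBound : ℕ
  conjBound = 2 + length L

  conjSize-normConj : ∀ xs → conjSize (normConj xs) ≤ conjBound
  conjSize-normConj xs with all? (_∈ᵃ? L) xs
  ... | yes _ = s≤s (m≤n⇒m≤1+n (length-filter (_∈ᵃ? xs) L))
  ... | no  _ = s≤s (s≤s z≤n)

  lamSize-normLam : ∀ l → lamSize (normLam l) ≤ conjBound
  lamSize-normLam nothing   = s≤s z≤n
  lamSize-normLam (just xs) = conjSize-normConj xs

  conjBound≤layers : ∀ b → conjBound ≤ suc b * (conjBound + conjBound + 2)
  conjBound≤layers b = ≤-trans (≤-trans (m≤m+n conjBound conjBound) (m≤m+n _ 2)) (m≤m+n _ (b * _))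

  querySize-normalise-truncate : ∀ b q →
    querySize (normalise (truncate b q)) ≤ suc b * (conjBound + conjBound + 2)
  querySize-normalise-truncate zero    q             = ≤-trans (conjSize-normConj []) (conjBound≤layers 0)
  querySize-normalise-truncate (suc b) (rho ρ)       = ≤-trans (conjSize-normConj ρ) (conjBound≤layers (suc b))
  querySize-normalise-truncate (suc b) (until ρ l q) = begin
    conjSize (normConj ρ) + lamSize (normLam l) + querySize (normalise (truncate b q)) + 2
      ≤⟨ +-monoˡ-≤ 2 (+-mono-≤ (+-mono-≤ (conjSize-normConj ρ) (lamSize-normLam l))
                               (querySize-normalise-truncate b q)) ⟩
    conjBound + conjBound + suc b * (conjBound + conjBound + 2) + 2
      ≡⟨ move-2 conjBound (suc b * (conjBound + conjBound + 2)) ⟩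
    suc (suc b) * (conjBound + conjBound + 2) ∎
    where
      open ≤-Reasoning
      move-2 : ∀ c r → c + c + r + 2 ≡ c + c + 2 + r
      move-2 = solve-∀

instances : ExampleSet → List DataInstance
instances E = pos E ++ neg E

exampleSize≡ : ∀ E → exampleSize E ≡ suc (sum (map instanceSize (instances E)))
exampleSize≡ (mkE ps ns) = sym (cong suc (begin
  sum (map instanceSize (ps ++ ns))                    ≡⟨ cong sum (map-++ instanceSize ps ns) ⟩
  sum (map instanceSize ps ++ map instanceSize ns)     ≡⟨ sum-++ (map instanceSize ps) (map instanceSize ns) ⟩
  sum (map instanceSize ps) + sum (map instanceSize ns) ∎))
  where open ≡-Reasoning

atomsOf : List DataInstance → List Atom
atomsOf []       = []
atomsOf (D ∷ Ds) = map proj₁ D ++ atomsOf Ds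

∈-atomsOf : ∀ {D Ds a ℓ} → D ∈ Ds → (a , ℓ) ∈ D → a ∈ atomsOf Ds
∈-atomsOf {D} (here refl)  a∈D = ∈-++⁺ˡ (∈-map⁺ proj₁ a∈D)
∈-atomsOf {Ds = D′ ∷ _} (there D∈Ds) a∈D = ∈-++⁺ʳ (map proj₁ D′) (∈-atomsOf D∈Ds a∈D)

length≤factSizes : ∀ D → length D ≤ sum (map factSize D)
length≤factSizes []            = z≤n
length≤factSizes ((a , ℓ) ∷ D) = s≤s (≤-trans (length≤factSizes D) (m≤n+m _ (suc ℓ)))

length-atomsOf≤ : ∀ Ds → length (atomsOf Ds) ≤ sum (map instanceSize Ds)
length-atomsOf≤ []       = z≤n
length-atomsOf≤ (D ∷ Ds) = begin
  length (map proj₁ D ++ atomsOf Ds)        ≡⟨ length-++ (map proj₁ D) ⟩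
  length (map proj₁ D) + length (atomsOf Ds) ≡⟨ cong (_+ length (atomsOf Ds)) (length-map proj₁ D) ⟩
  length D + length (atomsOf Ds)             ≤⟨ +-mono-≤ (m≤n⇒m≤1+n (length≤factSizes D)) (length-atomsOf≤ Ds) ⟩
  instanceSize D + sum (map instanceSize Ds) ∎
  where open ≤-Reasoning

timestamp<size : ∀ {D Ds a ℓ} → D ∈ Ds → (a , ℓ) ∈ D → ℓ < sum (map instanceSize Ds)
timestamp<size {D} {Ds} {a} {ℓ} D∈Ds a∈D = begin-strict
  ℓ                          <⟨ m<n⇒m<1+n (n<1+n ℓ) ⟩
  factSize (a , ℓ)           ≤⟨ ∈⇒≤sum (∈-map⁺ factSize a∈D) ⟩
  sum (map factSize D)       <⟨ n<1+n _ ⟩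
  instanceSize D             ≤⟨ ∈⇒≤sum (∈-map⁺ instanceSize D∈Ds) ⟩
  sum (map instanceSize Ds)  ∎
  where open ≤-Reasoning

canonical-atomsOf : ∀ {D Ds} → D ∈ Ds → AtomsIn (atomsOf Ds) (canonical D)
canonical-atomsOf {D} D∈Ds a n = ∈-atomsOf D∈Ds ∘ canonical⇒∈ D

entailed-suffix-trivial : ∀ {D Ds} q → D ∈ Ds → Entails D q → Trivial (suffix (sum (map instanceSize Ds)) q)
entailed-suffix-trivial {D} {Ds} q D∈Ds D⊨q =
  trivial-from (suffix-holds-later N q 0 (Equivalence.to (entails⇔canonical D q) D⊨q))
  where
    N = sum (map instanceSize Ds)
    trivial-from : ∃[ m ] (N + 0 ≤ m × canonical D , m ⊨ suffix N q) → Trivial (suffix N q)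
    trivial-from (m , N≤m , holds) = trivial-if-nothing-holds-beyond (suffix N q) m nothing-beyond holds
      where
        nothing-beyond : ∀ a k → m ≤ k → ¬ canonical D a k ≡ true
        nothing-beyond a k m≤k e =
          <⇒≱ (timestamp<size D∈Ds (canonical⇒∈ D e)) (≤-trans (≤-trans (m≤m+n N 0) N≤m) m≤k)

truncate-normalise-entails : ∀ {L D} b q → Trivial (suffix b q) → AtomsIn L (canonical D) →
  Entails D q ⇔ Entails D (Normalise.normalise L (truncate b q))
truncate-normalise-entails {L} {D} b q t D⊆L =
  entails-cong D (Normalise.normalise-equiv L D⊆L (truncate b q) 0 ⇔-∘ truncate-equiv b q t 0)

fresh-not-entailed : ∀ {L D} → AtomsIn L (canonical D) → ¬ Entails D (rho (fresh L ∷ []))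
fresh-not-entailed {L} {D} D⊆L D⊨fresh with p ∷ [] ← Equivalence.to (entails⇔canonical D _) D⊨fresh =
  fresh∉ L (D⊆L (fresh L) 0 p)

separates-transfer : ∀ {κ κ′} E → (∀ {D} → D ∈ instances E → Entails D κ ⇔ Entails D κ′) →
  Separates κ E → Separates κ′ E
separates-transfer E κ⇔κ′ (pos⊨κ , neg⊭κ) =
  All.tabulate (λ D∈pos → Equivalence.to (κ⇔κ′ (∈-++⁺ˡ D∈pos)) (All.lookup pos⊨κ D∈pos)) ,
  All.tabulate (λ D∈neg → All.lookup neg⊭κ D∈neg ∘ Equivalence.from (κ⇔κ′ (∈-++⁺ʳ (pos E) D∈neg)))

layers≤square : ∀ N K → K ≤ N → suc N * (2 + K + (2 + K) + 2) ≤ 4 * suc N ^ 2 + 4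
layers≤square N K K≤N = begin
  suc N * (2 + K + (2 + K) + 2)                 ≤⟨ *-monoʳ-≤ (suc N) (+-monoˡ-≤ 2 (+-mono-≤ (+-monoʳ-≤ 2 K≤N) (+-monoʳ-≤ 2 K≤N))) ⟩
  suc N * (2 + N + (2 + N) + 2)                 ≤⟨ m≤m+n _ (2 * N * N + 2) ⟩
  suc N * (2 + N + (2 + N) + 2) + (2 * N * N + 2) ≡⟨ expand N ⟩
  4 * (suc N * suc N) + 4                       ≡⟨ cong (λ y → 4 * (suc N * y) + 4) (*-identityʳ (suc N)) ⟨
  4 * suc N ^ 2 + 4                             ∎
  where
    open ≤-Reasoning
    expand : ∀ x → (1 + x) * (2 + x + (2 + x) + 2) + (2 * x * x + 2) ≡ 4 * ((1 + x) * (1 + x)) + 4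
    expand = solve-∀

lemma3 : ∃[ c ] ∃[ d ] ∀ (E : ExampleSet) → Separable E →
             ∃[ κ ] (Separates κ E × querySize κ ≤ c * exampleSize E ^ d + c)
lemma3 = 4 , 2 , separator
  where
    separator : ∀ E → Separable E → ∃[ κ ] (Separates κ E × querySize κ ≤ 4 * exampleSize E ^ 2 + 4)
    separator E@(mkE [] ns) _ =
      rho (fresh (atomsOf ns) ∷ []) ,
      ([] , All.tabulate (fresh-not-entailed ∘ canonical-atomsOf)) ,
      ≤-trans (m≤m+n 2 2) (m≤n+m 4 (4 * exampleSize E ^ 2))
    separator E@(mkE (D₀ ∷ _) _) (κ , κ-separates) =
      normalise (truncate N κ) ,
      separates-transfer E
        (λ D∈E → truncate-normalise-entails N κ trivial-tail (canonical-atomsOf {Ds = instances E} D∈E))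
        κ-separates ,
      subst (λ S → querySize (normalise (truncate N κ)) ≤ 4 * S ^ 2 + 4) (sym (exampleSize≡ E))
        (≤-trans (querySize-normalise-truncate N κ) (layers≤square N (length L) (length-atomsOf≤ (instances E))))
      where
        N = sum (map instanceSize (instances E))
        L = atomsOf (instances E)
        open Normalise L

        trivial-tail : Trivial (suffix N κ)
        trivial-tail = entailed-suffix-trivial {Ds = instances E} κ (here refl) (All.head (proj₁ κ-separates))
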